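{- Let $\Sigma$ be an alphabet with exactly two characters, let $a \in \Sigma$ and let $T$ be a string over $\Sigma$. Suppose that (1) $a \notin \mathsf{M}(T)$, (2) $a \in \mathsf{M}(aT)$, and (3) there exists a string $x \in \mathsf{M}(T) \setminus \{\varepsilon, T\}$ such that $ax \notin \mathsf{M}(T)$ and $ax \in \mathsf{M}(aT)$. Then $d_{aT}(a) < d_T(\varepsilon)$.
   Context: Strings are finite sequences of characters from $\Sigma$; $\varepsilon$ is the empty string. For a string $T$, $\mathrm{Substr}(T)$ is its set of substrings (including $\varepsilon$). A substring $u$ of $T$ is left-maximal in $T$ if $u$ is a prefix of $T$ or there are distinct characters $c \neq d$ with $cu, du \in \mathrm{Substr}(T)$; it is right-maximal in $T$ if $u$ is a suffix of $T$ or there are distinct characters $c\neq d$ with $uc, ud \in \mathrm{Substr}(T)$. $\mathsf{M}(T)$ is the set of substrings of $T$ that are both left- and right-maximal. For a string $w$, $d_T(w)$ is the number of distinct characters $c$ with $wc \in \mathrm{Substr}(T)$ (so $d_T(\varepsilon)$ is the number of distinct characters occurring in $T$). -}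

module Defs where

open import Data.Bool using (Bool; true; false)
open import Data.List using (List; []; _∷_; _++_; [_])
open import Data.Nat using (ℕ; zero; suc; _+_)
open import Data.Product using (Σ; ∃; ∃-syntax; _×_; _,_)
open import Data.Sum using (_⊎_; inj₁; inj₂)
open import Relation.Nullary using (Dec; yes; no; ¬_)
open import Relation.Binary.PropositionalEquality using (_≡_; _≢_; refl; cong)
open import Data.List.Properties using (++-assoc)
open import Data.Empty using (⊥-elim)

-- The alphabet Σ with exactly two characters is modelled by Bool.
Char : Set
Char = Bool

Str : Set
Str = List Char

Substr : Str → Str → Set
Substr T u = ∃[ p ] ∃[ s ] (p ++ u ++ s ≡ T)

Prefix : Str → Str → Set
Prefix T u = ∃[ s ] (u ++ s ≡ T)

Suffix : Str → Str → Set
Suffix T u = ∃[ p ] (p ++ u ≡ T)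

LeftMaximal : Str → Str → Set
LeftMaximal T u =
  Substr T u ×
  (Prefix T u ⊎ ∃[ c ] ∃[ d ] (c ≢ d × Substr T (c ∷ u) × Substr T (d ∷ u)))

RightMaximal : Str → Str → Set
RightMaximal T u =
  Substr T u ×
  (Suffix T u ⊎ ∃[ c ] ∃[ d ] (c ≢ d × Substr T (u ++ [ c ]) × Substr T (u ++ [ d ])))

InM : Str → Str → Set
InM T u = LeftMaximal T u × RightMaximal T u

private
  decBool : (x y : Bool) → Dec (x ≡ y)
  decBool true true = yes refl
  decBool false false = yes refl
  decBool true false = no (λ ())
  decBool false true = no (λ ())

  decStr : (x y : Str) → Dec (x ≡ y)
  decStr [] [] = yes refl
  decStr [] (_ ∷ _) = no (λ ())
  decStr (_ ∷ _) [] = no (λ ())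
  decStr (a ∷ x) (b ∷ y) with decBool a b | decStr x y
  ... | yes refl | yes refl = yes refl
  ... | no ne | _ = no (λ { refl → ne refl })
  ... | _ | no ne = no (λ { refl → ne refl })

  prefix? : (T u : Str) → Dec (Prefix T u)
  prefix? T [] = yes (T , refl)
  prefix? [] (_ ∷ _) = no (λ { (_ , ()) })
  prefix? (t ∷ T) (c ∷ u) with decBool c t | prefix? T u
  ... | yes refl | yes (s , eq) = yes (s , cong (c ∷_) eq)
  ... | no ne | _ = no (λ { (_ , refl) → ne refl })
  ... | yes refl | no np = no (λ { (s , refl) → np (s , refl) })

substr? : (T u : Str) → Dec (Substr T u)
substr? T u with prefix? T u
... | yes (s , eq) = yes ([] , s , eq)
substr? [] u | no np = no λ { ([] , s , eq) → np (s , eq) ; (_ ∷ _ , _ , ()) }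
substr? (t ∷ T) u | no np with substr? T u
... | yes (p , s , eq) = yes (t ∷ p , s , cong (t ∷_) eq)
... | no nq = no λ { ([] , s , eq) → np (s , eq)
                   ; (.t ∷ p , s , refl) → nq (p , s , refl) }

count : {P : Set} → Dec P → ℕ
count (yes _) = 1
count (no _) = 0

d : Str → Str → ℕ
d T w = count (substr? T (w ++ [ true ])) + count (substr? T (w ++ [ false ]))

-- Write b for the other letter. Right-maximality of ax in aT (with x ≠ T) forces a to
-- occur in T, and then a ∉ M(T) forbids aa in T: an occurrence of aa makes a left-maximal
-- (as a prefix, or via aa and ba) and right-maximal (via aa and ab, or as a suffix at its
-- last occurrence). So x cannot start with a, since aax would occur in aT only as a prefix
-- and thus have a unique right extension, forcing ax = aT. Hence x starts with b, and T
-- cannot start with a: abx is not a prefix of aaT, so its maximality in aT passes to T.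
-- Therefore T starts with b, both letters occur in T, and aT = abT contains ab but not aa.
module Submission where

open import Defs
open import Data.Bool using (true; false; not; _≟_)
open import Data.Bool.Properties using (not-¬; ¬-not)
open import Data.List using ([]; _∷_; [_]; _++_)
open import Data.List.Properties using (++-assoc; ++-identityʳ; ∷-injectiveˡ; ∷-injectiveʳ; ++-conicalˡ)
open import Data.Nat using (_<_; s≤s; z≤n)
open import Data.Product using (∃-syntax; _×_; _,_; proj₂)
open import Data.Sum using (_⊎_; inj₁; inj₂)
open import Relation.Nullary using (¬_; Dec; yes; no; contradiction)
open import Relation.Binary.PropositionalEquality
  using (_≡_; _≢_; refl; sym; trans; cong; subst₂; ≢-sym)

private
  variable
    a c e f : Char
    T u v : Str

substr-[] : Substr [] u → u ≡ []
substr-[] ([] , s , eq) = ++-conicalˡ _ s eq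

substr-∷⁺ : Substr T u → Substr (c ∷ T) u
substr-∷⁺ {c = c} (p , s , eq) = c ∷ p , s , cong (c ∷_) eq

substr-∷⁻ : Substr (c ∷ T) u → Prefix (c ∷ T) u ⊎ Substr T u
substr-∷⁻ ([] , s , eq) = inj₁ (s , eq)
substr-∷⁻ (_ ∷ p , s , eq) = inj₂ (p , s , ∷-injectiveʳ eq)

substr-∷-tail : Substr (c ∷ T) (e ∷ u) → Substr T u
substr-∷-tail ([] , s , eq) = [] , s , ∷-injectiveʳ eq
substr-∷-tail {e = e} {u = u} (_ ∷ p , s , eq) =
  p ++ [ e ] , s , trans (++-assoc p [ e ] (u ++ s)) (∷-injectiveʳ eq)

substr-++⁻ˡ : ∀ u → Substr T (u ++ v) → Substr T u
substr-++⁻ˡ {v = v} u (p , s , eq) = p , v ++ s , trans (cong (p ++_) (sym (++-assoc u v s))) eq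

substr-++⁻ʳ : ∀ u → Substr T (u ++ v) → Substr T v
substr-++⁻ʳ {v = v} u (p , s , eq) =
  p ++ u , s , trans (++-assoc p u (v ++ s)) (trans (cong (p ++_) (sym (++-assoc u v s))) eq)

prefix-++⁻ˡ : ∀ u → Prefix T (u ++ v) → Prefix T u
prefix-++⁻ˡ {v = v} u (s , eq) = v ++ s , trans (sym (++-assoc u v s)) eq

prefix-++-[]-unique : ∀ u → Prefix T (u ++ [ e ]) → Prefix T (u ++ [ f ]) → e ≡ f
prefix-++-[]-unique [] (_ , refl) (_ , eq) = sym (∷-injectiveˡ eq)
prefix-++-[]-unique (_ ∷ u) (s , refl) (s′ , eq) = prefix-++-[]-unique u (s , refl) (s′ , ∷-injectiveʳ eq)

substr-∷-nonprefix : ¬ Prefix (c ∷ T) u → Substr (c ∷ T) u → Substr T u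
substr-∷-nonprefix ¬pre o with substr-∷⁻ o
... | inj₁ pre = contradiction pre ¬pre
... | inj₂ o′ = o′

substr-∷-extension : Substr (c ∷ T) (e ∷ u) → Prefix T u ⊎ Substr T (e ∷ u)
substr-∷-extension ([] , s , eq) = inj₁ (s , ∷-injectiveʳ eq)
substr-∷-extension (_ ∷ p , s , eq) = inj₂ (p , s , ∷-injectiveʳ eq)

leftMaximal-∷⁻ : ¬ Prefix (c ∷ T) u → LeftMaximal (c ∷ T) u → LeftMaximal T u
leftMaximal-∷⁻ ¬pre (_ , inj₁ pre) = contradiction pre ¬pre
leftMaximal-∷⁻ ¬pre (o , inj₂ (e , f , e≢f , oe , of))
  with substr-∷-extension oe | substr-∷-extension of
... | inj₁ pre | _ = substr-∷-nonprefix ¬pre o , inj₁ pre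
... | _ | inj₁ pre = substr-∷-nonprefix ¬pre o , inj₁ pre
... | inj₂ oe′ | inj₂ of′ = substr-∷-nonprefix ¬pre o , inj₂ (e , f , e≢f , oe′ , of′)

rightMaximal-∷⁻ : ¬ Prefix (c ∷ T) u → RightMaximal (c ∷ T) u → RightMaximal T u
rightMaximal-∷⁻ {u = u} ¬pre (_ , inj₁ ([] , eq)) = contradiction ([] , trans (++-identityʳ u) eq) ¬pre
rightMaximal-∷⁻ ¬pre (o , inj₁ (_ ∷ p , eq)) = substr-∷-nonprefix ¬pre o , inj₁ (p , ∷-injectiveʳ eq)
rightMaximal-∷⁻ {u = u} ¬pre (o , inj₂ (e , f , e≢f , oe , of)) =
  substr-∷-nonprefix ¬pre o , inj₂ (e , f , e≢f , extension oe , extension of)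
  where
  extension : ∀ {g} → Substr _ (u ++ [ g ]) → Substr _ (u ++ [ g ])
  extension = substr-∷-nonprefix (λ pre → ¬pre (prefix-++⁻ˡ u pre))

InM-∷⁻ : ¬ Prefix (c ∷ T) u → InM (c ∷ T) u → InM T u
InM-∷⁻ ¬pre (left , right) = leftMaximal-∷⁻ ¬pre left , rightMaximal-∷⁻ ¬pre right

≢-≢⇒≡ : c ≢ e → f ≢ e → f ≡ c
≢-≢⇒≡ c≢e f≢e = trans (¬-not f≢e) (sym (¬-not c≢e))

substr-∷-first-change : ∀ s → c ≢ e → Substr (c ∷ s) [ e ] → Substr (c ∷ s) (c ∷ e ∷ [])
substr-∷-first-change s c≢e o with substr-∷⁻ o
... | inj₁ (_ , eq) = contradiction (sym (∷-injectiveˡ eq)) c≢e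
substr-∷-first-change [] c≢e o | inj₂ o′ with () ← substr-[] o′
substr-∷-first-change {e = e} (f ∷ s) c≢e o | inj₂ o′ with f ≟ e
... | yes refl = [] , s , refl
... | no f≢e rewrite ≢-≢⇒≡ c≢e f≢e = substr-∷⁺ (substr-∷-first-change s c≢e o′)

suffix-of-last-occurrence : ∀ T → Substr T [ c ] → ¬ Substr T (c ∷ not c ∷ []) → Suffix T [ c ]
suffix-of-last-occurrence [] o _ with () ← substr-[] o
suffix-of-last-occurrence {c} (e ∷ T) o ¬c¬c with substr? T [ c ]
... | yes o′ with p , eq ← suffix-of-last-occurrence T o′ (λ o″ → ¬c¬c (substr-∷⁺ o″)) =
  e ∷ p , cong (e ∷_) eq
... | no c∉T with substr-∷⁻ o
...   | inj₂ o′ = contradiction o′ c∉T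
...   | inj₁ (_ , refl) with T
...     | [] = [] , refl
...     | f ∷ T′ with f ≟ c
...       | yes refl = contradiction ([] , T′ , refl) c∉T
...       | no f≢c rewrite ¬-not f≢c = contradiction ([] , T′ , refl) ¬c¬c

leftMaximal-of-aa : Substr T (a ∷ a ∷ []) → LeftMaximal T [ a ]
leftMaximal-of-aa {[]} aa with () ← substr-[] aa
leftMaximal-of-aa {c ∷ T} {a} aa with c ≟ a
... | yes refl = substr-++⁻ˡ [ a ] aa , inj₁ (T , refl)
... | no c≢a = substr-++⁻ˡ [ a ] aa ,
  inj₂ (a , c , (≢-sym c≢a) , aa , substr-∷-first-change T c≢a (substr-++⁻ˡ [ a ] aa))

rightMaximal-of-aa : Substr T (a ∷ a ∷ []) → RightMaximal T [ a ]
rightMaximal-of-aa {T} {a} aa with substr? T (a ∷ not a ∷ [])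
... | yes ab = substr-++⁻ˡ [ a ] aa , inj₂ (a , not a , not-¬ refl , aa , ab)
... | no ¬ab = substr-++⁻ˡ [ a ] aa , inj₁ (suffix-of-last-occurrence T (substr-++⁻ˡ [ a ] aa) ¬ab)

¬InM⇒aa-free : ¬ InM T [ a ] → ¬ Substr T (a ∷ a ∷ [])
¬InM⇒aa-free a∉M aa = a∉M (leftMaximal-of-aa aa , rightMaximal-of-aa aa)

rightMaximal-∷-occurs : RightMaximal (a ∷ T) (a ∷ v) → v ≢ T → Substr T [ a ]
rightMaximal-∷-occurs (_ , inj₁ ([] , eq)) v≢T = contradiction (∷-injectiveʳ eq) v≢T
rightMaximal-∷-occurs {v = v} (_ , inj₁ (_ ∷ p , eq)) _ = p , v , ∷-injectiveʳ eq
rightMaximal-∷-occurs {a} {v = v} (_ , inj₂ (e , f , e≢f , oe , of)) _ with e ≟ a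
... | yes refl = substr-++⁻ʳ v (substr-∷-tail oe)
... | no e≢a rewrite ≢-≢⇒≡ (≢-sym e≢a) (≢-sym e≢f) =
  substr-++⁻ʳ v (substr-∷-tail of)

aa-free⇒prefix : ¬ Substr T (a ∷ a ∷ []) → Substr (a ∷ T) (a ∷ a ∷ u) → Prefix T (a ∷ u)
aa-free⇒prefix aa∉T o with substr-∷⁻ o
... | inj₁ (s , eq) = s , ∷-injectiveʳ eq
... | inj₂ o′ = contradiction (substr-++⁻ˡ (_ ∷ _ ∷ []) o′) aa∉T

rightMaximal-aa⇒≡ : ¬ Substr T (a ∷ a ∷ []) → RightMaximal (a ∷ T) (a ∷ a ∷ v) → a ∷ v ≡ T
rightMaximal-aa⇒≡ _ (_ , inj₁ ([] , eq)) = ∷-injectiveʳ eq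
rightMaximal-aa⇒≡ {v = v} aa∉T (_ , inj₁ (_ ∷ p , eq)) =
  contradiction (substr-++⁻ˡ (_ ∷ _ ∷ []) (p , v , ∷-injectiveʳ eq)) aa∉T
rightMaximal-aa⇒≡ {v = v} aa∉T (_ , inj₂ (e , f , e≢f , oe , of)) =
  contradiction (prefix-++-[]-unique (_ ∷ v) (aa-free⇒prefix aa∉T oe) (aa-free⇒prefix aa∉T of)) e≢f

count-yes : ∀ {P : Set} (p? : Dec P) → P → count p? ≡ 1
count-yes (yes _) _ = refl
count-yes (no ¬p) p = contradiction p ¬p

count-no : ∀ {P : Set} (p? : Dec P) → ¬ P → count p? ≡ 0
count-no (yes p) ¬p = contradiction p ¬p
count-no (no _) _ = refl

d-≡-2 : ∀ X w → e ≢ f → Substr X (w ++ [ e ]) → Substr X (w ++ [ f ]) → d X w ≡ 2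
d-≡-2 {true} {true} _ _ e≢f _ _ = contradiction refl e≢f
d-≡-2 {false} {false} _ _ e≢f _ _ = contradiction refl e≢f
d-≡-2 {true} {false} X w _ oe of
  rewrite count-yes (substr? X (w ++ [ true ])) oe | count-yes (substr? X (w ++ [ false ])) of = refl
d-≡-2 {false} {true} X w _ oe of
  rewrite count-yes (substr? X (w ++ [ true ])) of | count-yes (substr? X (w ++ [ false ])) oe = refl

d-≡-1 : ∀ X w → e ≢ f → ¬ Substr X (w ++ [ e ]) → Substr X (w ++ [ f ]) → d X w ≡ 1
d-≡-1 {true} {true} _ _ e≢f _ _ = contradiction refl e≢f
d-≡-1 {false} {false} _ _ e≢f _ _ = contradiction refl e≢f
d-≡-1 {true} {false} X w _ ¬oe of
  rewrite count-no (substr? X (w ++ [ true ])) ¬oe | count-yes (substr? X (w ++ [ false ])) of = refl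
d-≡-1 {false} {true} X w _ ¬oe of
  rewrite count-yes (substr? X (w ++ [ true ])) of | count-no (substr? X (w ++ [ false ])) ¬oe = refl

d-<-of-distinct-head : c ≢ a → Substr (c ∷ T) [ a ] → ¬ Substr (c ∷ T) (a ∷ a ∷ []) →
  d (a ∷ c ∷ T) [ a ] < d (c ∷ T) []
d-<-of-distinct-head {c} {a} {T} c≢a a∈cT aa∉cT = subst₂ _<_ (sym one) (sym two) (s≤s (s≤s z≤n))
  where
  a≢c : a ≢ c
  a≢c = ≢-sym c≢a
  one : d (a ∷ c ∷ T) [ a ] ≡ 1
  one = d-≡-1 (a ∷ c ∷ T) [ a ] a≢c
    (λ aa → aa∉cT (substr-∷-nonprefix (λ (_ , eq) → a≢c (∷-injectiveˡ (∷-injectiveʳ eq))) aa))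
    ([] , T , refl)
  two : d (c ∷ T) [] ≡ 2
  two = d-≡-2 (c ∷ T) [] a≢c a∈cT ([] , T , refl)

lemma2 : (a : Char) (T : Str) →
    ¬ InM T [ a ] →
    InM (a ∷ T) [ a ] →
    (∃[ x ] (InM T x × x ≢ [] × x ≢ T × ¬ InM T (a ∷ x) × InM (a ∷ T) (a ∷ x))) →
    d (a ∷ T) [ a ] < d T []
lemma2 a [] _ _ (_ , _ , _ , x≢T , _ , ax∈M)
  with () ← substr-[] (rightMaximal-∷-occurs (proj₂ ax∈M) x≢T)
lemma2 a (c ∷ T) _ _ ([] , _ , x≢[] , _) = contradiction refl x≢[]
lemma2 a (c ∷ T) a∉M _ (e ∷ x , _ , _ , x≢T , ax∉M , ax∈M) with e ≟ a | c ≟ a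
... | yes refl | _ = contradiction (rightMaximal-aa⇒≡ (¬InM⇒aa-free a∉M) (proj₂ ax∈M)) x≢T
... | no e≢a | yes refl =
  contradiction (InM-∷⁻ (λ (_ , eq) → e≢a (∷-injectiveˡ (∷-injectiveʳ eq))) ax∈M) ax∉M
... | no _ | no c≢a =
  d-<-of-distinct-head c≢a (rightMaximal-∷-occurs (proj₂ ax∈M) x≢T) (¬InM⇒aa-free a∉M)
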